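{- ($\mathbf{PRS\omega}$) Let $S$ and $T$ be set-sized prae-dilators and let $\eta^0:S\Rightarrow T$ be a natural equivalence with $\operatorname{supp}^T_n\circ\eta^0_n=\operatorname{supp}^S_n$ for all $n$. Then one can construct a natural equivalence $\eta:D^S\Rightarrow D^T$ with $\operatorname{supp}^{D^T}_X\circ\eta_X=\operatorname{supp}^{D^S}_X$ for every linear order $X$.
   Context: $\mathbf{PRS\omega}$ is primitive recursive set theory with infinity. $[X]^{<\omega}$ is the set of finite subsets of $X$, $[f]^{<\omega}(a)=\{f(s)\mid s\in a\}$. The category of natural numbers has objects $n=\{0,\dots,n-1\}$ and order embeddings as morphisms. For a finite linear order $a$, $|a|$ is its cardinality, $\operatorname{en}_a:|a|\rightarrow a$ the order isomorphism; for $c\subseteq d$, $\iota_c^d$ is the inclusion, and for finite $c\subseteq d$, $|\iota_c^d|:|c|\rightarrow|d|$ is the order preserving map with $\operatorname{en}_d\circ|\iota_c^d|=\iota_c^d\circ\operatorname{en}_c$. A set-sized prae-dilator is a functor $T$ from the category of natural numbers to linear orders (with order embeddings as morphisms) with a natural transformation $\operatorname{supp}^T:T\Rightarrow[\cdot]^{<\omega}$ such that for every $n$ and $\sigma\in T_n$, with $a=\operatorname{supp}^T_n(\sigma)$, $\sigma$ lies in the range of $T_{\iota_a^n\circ\operatorname{en}_a}$. For such $T$ and a linear order $X$: $D^T_X=\{\langle a,\sigma\rangle\mid a\in[X]^{<\omega},\sigma\in T_{|a|},\operatorname{supp}^T_{|a|}(\sigma)=|a|\}$ with $\langle a,\sigma\rangle<_{D^T_X}\langle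 b,\tau\rangle$ iff $T_{|\iota_a^{a\cup b}|}(\sigma)<_{T_{|a\cup b|}}T_{|\iota_b^{a\cup b}|}(\tau)$; for an embedding $f:X\rightarrow Y$, $D^T_f(\langle a,\sigma\rangle)=\langle[f]^{<\omega}(a),\sigma\rangle$; and $\operatorname{supp}^{D^T}_X(\langle a,\sigma\rangle)=a$. A natural equivalence is a natural transformation whose components are order isomorphisms. -}

module Defs where

open import Level using (0ℓ)
open import Data.Nat using (ℕ)
open import Data.Fin using (Fin) renaming (_<_ to _<ᶠ_)
open import Data.Fin.Properties using () renaming (<-isStrictTotalOrder to <ᶠ-isSTO)
open import Data.Vec using (Vec; lookup; toList) renaming (map to vmap)
open import Data.Vec.Properties using (lookup-map)
open import Data.Vec.Membership.Propositional using (_∈_)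
open import Data.List using (List; allFin) renaming (map to lmap)
open import Data.Product using (Σ; Σ-syntax; ∃; _×_; _,_)
open import Data.Sum using (_⊎_)
open import Function using (_∘_; _⇔_)
open import Relation.Binary.Core using (Rel)
open import Relation.Binary.Structures using (IsStrictTotalOrder)
open import Relation.Binary.PropositionalEquality
  using (_≡_; _≗_; subst; subst₂; sym)

record LinOrd : Set₁ where
  field
    Carrier : Set
    _<_     : Rel Carrier 0ℓ
    isSTO   : IsStrictTotalOrder _≡_ _<_
open LinOrd public using (Carrier)

record OEmb (X Y : LinOrd) : Set where
  field
    fun  : Carrier X → Carrier Y
    mono : ∀ {x y} → LinOrd._<_ X x y → LinOrd._<_ Y (fun x) (fun y)
open OEmb public

-- Finite subsets of a linear order, represented by their increasing
-- enumeration: a = {e 0 < e 1 < ... < e (size-1)}, en_a = lookup elems.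

record FS (A : Set) (_<_ : Rel A 0ℓ) : Set where
  field
    size   : ℕ
    elems  : Vec A size
    sorted : ∀ {i j} → i <ᶠ j → lookup elems i < lookup elems j
open FS public

_≐_ : ∀ {A _<_} → FS A _<_ → FS A _<_ → Set
a ≐ b = toList (elems a) ≡ toList (elems b)

mapFS : ∀ {A B : Set} {_<A_ : Rel A 0ℓ} {_<B_ : Rel B 0ℓ} (f : A → B) →
        (∀ {x y} → x <A y → f x <B f y) → FS A _<A_ → FS B _<B_
mapFS {_<B_ = _<B_} f m a = record
  { size = size a
  ; elems = vmap f (elems a)
  ; sorted = λ {i} {j} i<j →
      subst₂ _<B_ (sym (lookup-map i f (elems a))) (sym (lookup-map j f (elems a)))
             (m (sorted a i<j)) }

-- The category of natural numbers: objects n = Fin n, order embeddings.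

record Emb (m n : ℕ) : Set where
  field
    emb     : Fin m → Fin n
    emb-mono : ∀ {i j} → i <ᶠ j → emb i <ᶠ emb j
open Emb public

idE : ∀ n → Emb n n
idE n = record { emb = λ i → i ; emb-mono = λ p → p }

_∘E_ : ∀ {k m n} → Emb m n → Emb k m → Emb k n
g ∘E f = record { emb = emb g ∘ emb f ; emb-mono = emb-mono g ∘ emb-mono f }

FSub : ℕ → Set
FSub n = FS (Fin n) _<ᶠ_

enum : ∀ {n} (a : FSub n) → Emb (size a) n
enum a = record { emb = lookup (elems a) ; emb-mono = sorted a }

record PraeDilator : Set₁ where
  field
    Ob     : ℕ → Set
    _<T_   : ∀ {n} → Rel (Ob n) 0ℓ
    isSTO  : ∀ n → IsStrictTotalOrder _≡_ (_<T_ {n})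
    mor    : ∀ {m n} → Emb m n → Ob m → Ob n
    -- T is a function on morphisms (morphisms are determined by their graph)
    mor-cong : ∀ {m n} (f g : Emb m n) → emb f ≗ emb g → ∀ σ → mor f σ ≡ mor g σ
    mor-id   : ∀ {n} (σ : Ob n) → mor (idE n) σ ≡ σ
    mor-∘    : ∀ {k m n} (g : Emb m n) (f : Emb k m) (σ : Ob k) →
               mor (g ∘E f) σ ≡ mor g (mor f σ)
    mor-mono : ∀ {m n} (f : Emb m n) {σ τ : Ob m} → σ <T τ → mor f σ <T mor f τ
    supp     : ∀ {n} → Ob n → FSub n
    supp-nat : ∀ {m n} (f : Emb m n) (σ : Ob m) →
               toList (elems (supp (mor f σ))) ≡ lmap (emb f) (toList (elems (supp σ)))
    supp-cond : ∀ {n} (σ : Ob n) → Σ[ τ ∈ Ob (size (supp σ)) ] mor (enum (supp σ)) τ ≡ σ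
open PraeDilator public

record IsOrderIso {A B : Set} (_≈A_ : Rel A 0ℓ) (_≈B_ : Rel B 0ℓ)
                  (_<A_ : Rel A 0ℓ) (_<B_ : Rel B 0ℓ) (h : A → B) : Set where
  field
    resp     : ∀ {x y} → x ≈A y → h x ≈B h y
    injective : ∀ {x y} → h x ≈B h y → x ≈A y
    surjective : ∀ y → Σ[ x ∈ A ] h x ≈B y
    preserves : ∀ {x y} → x <A y → h x <B h y
    reflects  : ∀ {x y} → h x <B h y → x <A y

record IsNatEquiv (S T : PraeDilator) (η : ∀ n → Ob S n → Ob T n) : Set where
  field
    natural : ∀ {m n} (f : Emb m n) (σ : Ob S m) → η n (mor S f σ) ≡ mor T f (η m σ)
    iso     : ∀ n → IsOrderIso _≡_ _≡_ (_<T_ S) (_<T_ T) (η n)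

module _ (T : PraeDilator) (X : LinOrd) where
  private
    _<X_ = LinOrd._<_ X

  FSX : Set
  FSX = FS (Carrier X) _<X_

  record DElem : Set where
    constructor ⟨_,_,_⟩
    field
      set  : FSX
      σ    : Ob T (size set)
      full : toList (elems (supp T σ)) ≡ allFin (size set)
  open DElem public

  _≈D_ : Rel DElem 0ℓ
  x ≈D y = Σ[ e ∈ size (set x) ≡ size (set y) ]
             (subst (Vec (Carrier X)) e (elems (set x)) ≡ elems (set y)
              × subst (Ob T) e (σ x) ≡ σ y)

  IsIncl : (c d : FSX) → Emb (size c) (size d) → Set
  IsIncl c d f = ∀ i → lookup (elems d) (emb f i) ≡ lookup (elems c) i

  IsUnion : (a b d : FSX) → Set
  IsUnion a b d = ∀ x → (x ∈ elems d) ⇔ ((x ∈ elems a) ⊎ (x ∈ elems b))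

  _<D_ : Rel DElem 0ℓ
  x <D y = Σ[ d ∈ FSX ] IsUnion (set x) (set y) d ×
           Σ[ f ∈ Emb (size (set x)) (size d) ] IsIncl (set x) d f ×
           Σ[ g ∈ Emb (size (set y)) (size d) ] IsIncl (set y) d g ×
           _<T_ T (mor T f (σ x)) (mor T g (σ y))

  suppD : DElem → FSX
  suppD = set

Dmap : (T : PraeDilator) {X Y : LinOrd} → OEmb X Y → DElem T X → DElem T Y
Dmap T f x = ⟨ mapFS (fun f) (mono f) (DElem.set x) , DElem.σ x , DElem.full x ⟩

module Submission where

-- The component at a linear order X keeps the finite set and applies η⁰
-- to the term:  η_X ⟨a, σ⟩ = ⟨a, η⁰_{|a|}(σ)⟩.  Everything reduces to
-- three facts about η⁰:
--   * it preserves and reflects "full support" (supp σ = |a|), because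
--     supp^T ∘ η⁰ = supp^S; so η_X is well defined and surjective;
--   * it commutes with transport along equalities of cardinalities, so
--     η_X respects and reflects equality of D-elements;
--   * being natural and an order isomorphism, it preserves and reflects
--     the comparison T_f(σ) < T_g(τ) used to define the order of D.
-- Naturality of η and preservation of supports then hold by computation,
-- since D_f and supp^D only touch the finite-set component.

open import Defs
open import Data.Product using (Σ; Σ-syntax; _×_; _,_)
open import Data.Vec using (toList)
open import Data.List using (allFin)
open import Relation.Binary.PropositionalEquality
  using (_≡_; refl; sym; trans; cong; subst; subst₂)
open import Relation.Binary.PropositionalEquality.Properties
  using (subst-application′)

module Lift (S T : PraeDilator) (η⁰ : ∀ n → Ob S n → Ob T n)
            (η⁰-equiv : IsNatEquiv S T η⁰)
            (η⁰-supp : ∀ n (σ : Ob S n) → supp T (η⁰ n σ) ≐ supp S σ) where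
  open IsNatEquiv η⁰-equiv
  module η⁰-iso n = IsOrderIso (iso n)

  η⁰-full : ∀ {n} (σ : Ob S n) →
            toList (elems (supp S σ)) ≡ allFin n →
            toList (elems (supp T (η⁰ n σ))) ≡ allFin n
  η⁰-full σ full = trans (η⁰-supp _ σ) full

  η⁰-full⁻ : ∀ {n} (σ : Ob S n) →
             toList (elems (supp T (η⁰ n σ))) ≡ allFin n →
             toList (elems (supp S σ)) ≡ allFin n
  η⁰-full⁻ σ full = trans (sym (η⁰-supp _ σ)) full

  η⁰-preserves-cmp : ∀ {m m' n} (f : Emb m n) (g : Emb m' n) {σ τ} →
                     _<T_ S (mor S f σ) (mor S g τ) →
                     _<T_ T (mor T f (η⁰ m σ)) (mor T g (η⁰ m' τ))
  η⁰-preserves-cmp f g {σ} {τ} lt =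
    subst₂ (_<T_ T) (natural f σ) (natural g τ) (η⁰-iso.preserves _ lt)

  η⁰-reflects-cmp : ∀ {m m' n} (f : Emb m n) (g : Emb m' n) {σ τ} →
                    _<T_ T (mor T f (η⁰ m σ)) (mor T g (η⁰ m' τ)) →
                    _<T_ S (mor S f σ) (mor S g τ)
  η⁰-reflects-cmp f g {σ} {τ} lt =
    η⁰-iso.reflects _ (subst₂ (_<T_ T) (sym (natural f σ)) (sym (natural g τ)) lt)

  η : ∀ X → DElem S X → DElem T X
  η X ⟨ a , σ , full ⟩ = ⟨ a , η⁰ _ σ , η⁰-full σ full ⟩

  -- Each component η_X is an order isomorphism D^S_X ≅ D^T_X.  Equality of
  -- D-elements compares terms after transport along |a| = |b|, which
  -- commutes with η⁰ (subst-application′).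
  η-iso : ∀ X → IsOrderIso (_≈D_ S X) (_≈D_ T X) (_<D_ S X) (_<D_ T X) (η X)
  η-iso X = record
    { resp       = λ {x} {y} → resp {x} {y}
    ; injective  = λ {x} {y} → injective {x} {y}
    ; surjective = surjective
    ; preserves  = λ { (d , d-union , f , f-incl , g , g-incl , lt) →
        d , d-union , f , f-incl , g , g-incl , η⁰-preserves-cmp f g lt }
    ; reflects   = λ { (d , d-union , f , f-incl , g , g-incl , lt) →
        d , d-union , f , f-incl , g , g-incl , η⁰-reflects-cmp f g lt }
    }
    where
    resp : ∀ {x y} → _≈D_ S X x y → _≈D_ T X (η X x) (η X y)
    resp (e , same-set , same-σ) =
      e , same-set , trans (subst-application′ (Ob S) η⁰ e) (cong (η⁰ _) same-σ)

    injective : ∀ {x y} → _≈D_ T X (η X x) (η X y) → _≈D_ S X x y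
    injective (e , same-set , same-ησ) =
      e , same-set ,
      η⁰-iso.injective _ (trans (sym (subst-application′ (Ob S) η⁰ e)) same-ησ)

    surjective : ∀ y → Σ[ x ∈ DElem S X ] _≈D_ T X (η X x) y
    surjective ⟨ b , τ , full ⟩ with η⁰-iso.surjective _ τ
    ... | σ , refl = ⟨ b , σ , η⁰-full⁻ σ full ⟩ , refl , refl , refl

  η-natural : ∀ X Y (f : OEmb X Y) (x : DElem S X) →
              _≈D_ T Y (Dmap T f (η X x)) (η Y (Dmap S f x))
  η-natural X Y f x = refl , refl , refl

  η-supp : ∀ X (x : DElem S X) → suppD T X (η X x) ≐ suppD S X x
  η-supp X x = refl

lemma2p6 : (S T : PraeDilator) (η⁰ : ∀ n → Ob S n → Ob T n) →
           IsNatEquiv S T η⁰ →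
           (∀ n (σ : Ob S n) → supp T (η⁰ n σ) ≐ supp S σ) →
           Σ[ η ∈ (∀ X → DElem S X → DElem T X) ]
             ((∀ X → IsOrderIso (_≈D_ S X) (_≈D_ T X) (_<D_ S X) (_<D_ T X) (η X))
              × (∀ X Y (f : OEmb X Y) (x : DElem S X) →
                   _≈D_ T Y (Dmap T f (η X x)) (η Y (Dmap S f x)))
              × (∀ X (x : DElem S X) → suppD T X (η X x) ≐ suppD S X x))
lemma2p6 S T η⁰ η⁰-equiv η⁰-supp = η , η-iso , η-natural , η-supp
  where open Lift S T η⁰ η⁰-equiv η⁰-supp
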